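{- Let $u=u_0u_1\dots u_{k-1}$ be a word over $\Sigma$ with $u_0=0$ and $k\ge 2$. Then $\Delta(\mathrm{K}(u))=\mathrm{T}(\Delta_T(u))$, i.e. for all $n\ge1$, $\mathrm{K}(u)(n)-\mathrm{K}(u)(n-1)=\mathrm{T}(\Delta(u)\,\rho_{ -u_{k-1}})(n)$.
   Context: $\Sigma$ is a fixed finite cyclic (additive) group. Keane product on finite words over $\Sigma$: $u\times\varepsilon=\varepsilon$, $u\times(a v)=(u+a)(u\times v)$, where $u+a$ adds $a$ to every letter of $u$. Set $u^{\times 0}=0$, $u^{\times(n+1)}=u\times u^{\times n}$. For $u$ with $u_0=0$ and $|u|\ge2$, the Keane word $\mathrm{K}(u)=\lim_n u^{\times n}$ is an infinite word indexed by $0,1,2,\dots$. The first difference of a word $x=x_0x_1\dots$ is $\Delta(x)=(x_1-x_0)(x_2-x_1)\dots$ (empty if $|x|=1$); for infinite $x$ it is indexed so that $\Delta(x)(n)=x_n-x_{n-1}$, $n\ge1$. $\Delta_T(u)=\Delta(u)\,\rho_d$ with $d=-u_{|u|-1}$, where $\rho_d$ is the bijection $x\mapsto x+d$ of $\Sigma$. Toeplitz words: gaps are bijections of $\Sigma$; for words $x,y$ over $\Sigma\cup\mathrm{S}_\Sigma$, $x\langle y\rangle$ fills the gaps of $x$ in order: $(a\,x)\langle y\rangle=a\,x\langle y\rangle$, $(f\,x)\langle b\,y\rangle=f(b)\,x\langle y\rangle$, $(f\,x)\langle g\,y\rangle=(f\circ g)\,x\langle y\rangle$. For a pattern $P$ with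 first symbol in $\Sigma$, $T_0=?^\omega$ ($?$ the identity), $T_{i+1}=P^\omega\langle T_i\rangle$, $\mathrm{T}(P)=\lim_iT_i$, indexed by positive integers. -}

module Defs where

open import Data.Nat using (ℕ; zero; suc; _+_; _∸_; _≤_)
open import Data.Nat.DivMod using (_mod_)
open import Data.Fin using (Fin; toℕ)
open import Data.List using (List; []; _∷_; _++_; map; zipWith; length; lookup)
open import Data.Maybe using (Maybe; just; nothing; fromMaybe)
open import Data.Sum using (_⊎_; inj₁; inj₂)
open import Data.Product using (Σ; ∃; _×_)
open import Function using (_∘_; id)
open import Relation.Binary.PropositionalEquality using (_≡_)

-- The fixed finite cyclic group Σ = ℤ/(suc m)ℤ, represented on Fin (suc m).
Alph : ℕ → Set
Alph m = Fin (suc m)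

_!?_ : {A : Set} → List A → ℕ → Maybe A
[] !? _ = nothing
(x ∷ xs) !? zero = just x
(x ∷ xs) !? suc i = xs !? i

module _ {m : ℕ} where

  infixl 6 _⊕_ _⊖_

  _⊕_ : Alph m → Alph m → Alph m
  a ⊕ b = (toℕ a + toℕ b) mod (suc m)

  ⊖_ : Alph m → Alph m
  ⊖ a = (suc m ∸ toℕ a) mod (suc m)

  _⊖_ : Alph m → Alph m → Alph m
  a ⊖ b = a ⊕ (⊖ b)

  lastOr : Alph m → List (Alph m) → Alph m
  lastOr d [] = d
  lastOr d (x ∷ xs) = lastOr x xs

  _×K_ : List (Alph m) → List (Alph m) → List (Alph m)
  u ×K [] = []
  u ×K (a ∷ v) = map (_⊕ a) u ++ (u ×K v)

  kpow : List (Alph m) → ℕ → List (Alph m)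
  kpow u zero = Data.Fin.zero ∷ []
  kpow u (suc n) = u ×K kpow u n

  -- x is the limit (Keane word) of the finite words u^{×n}:
  -- every position i is eventually defined and constantly equal to x i.
  IsKeaneWord : List (Alph m) → (ℕ → Alph m) → Set
  IsKeaneWord u x = ∀ i → ∃ λ N → ∀ n → N ≤ n → kpow u n !? i ≡ just (x i)

  Δ : List (Alph m) → List (Alph m)
  Δ [] = []
  Δ (x ∷ xs) = zipWith (λ a b → b ⊖ a) (x ∷ xs) xs

  -- Toeplitz words. Symbols: letters (inj₁) or gaps (inj₂), a gap being
  -- a map Σ → Σ (only bijections ρ_d, id and their composites occur).
  Sym : Set
  Sym = Alph m ⊎ (Alph m → Alph m)

  ρ : Alph m → (Alph m → Alph m)
  ρ d x = x ⊕ d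

  ΔT : List (Alph m) → List Sym
  ΔT u = map inj₁ (Δ u) ++ (inj₂ (ρ (⊖ lastOr Data.Fin.zero u)) ∷ [])

  -- P^ω for a nonempty pattern, as an infinite word indexed from 0
  periodic : List Sym → ℕ → Sym
  periodic [] j = inj₂ id   -- never used (patterns are nonempty)
  periodic (s ∷ ss) j = lookup (s ∷ ss) (j mod suc (length ss))

  isGap : Sym → ℕ
  isGap (inj₁ _) = 0
  isGap (inj₂ _) = 1

  gapsBefore : (ℕ → Sym) → ℕ → ℕ
  gapsBefore x zero = 0
  gapsBefore x (suc j) = gapsBefore x j + isGap (x j)

  fillWith : (Alph m → Alph m) → Sym → Sym
  fillWith f (inj₁ b) = inj₁ (f b)
  fillWith f (inj₂ g) = inj₂ (f ∘ g)

  -- x⟨y⟩ : the j-th gap of x (in order) is filled with the j-th symbol of y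
  fill : (ℕ → Sym) → (ℕ → Sym) → ℕ → Sym
  fill x y j with x j
  ... | inj₁ a = inj₁ a
  ... | inj₂ f = fillWith f (y (gapsBefore x j))

  Tseq : List Sym → ℕ → ℕ → Sym
  Tseq P zero = λ _ → inj₂ id
  Tseq P (suc i) = fill (periodic P) (Tseq P i)

  -- y is the limit T(P): position j (i.e. position j+1 in the paper's
  -- 1-based indexing) is eventually the constant letter y j.
  IsToeplitzWord : List Sym → (ℕ → Alph m) → Set
  IsToeplitzWord P y = ∀ j → ∃ λ N → ∀ n → N ≤ n → Tseq P n j ≡ inj₁ (y j)

-- Let u = u₀ u₁ … u_{k-1} with u₀ = 0 and k ≥ 2.  The proof is by explicit
-- closed forms for both infinite words, read off from base-k digits.
--
--  * Keane side.  The letter of u × v at position r + q·k (r < k) is u_r + v_q.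
--    Hence every power u^{×n} is a prefix of the word K with
--        K(r + q·k) = u_r + K(q),          K(0) = 0,
--    and K is the (unique) limit of the powers u^{×n}.
--  * Toeplitz side.  The pattern Δ_T(u) has period k, letters u_{r+1} − u_r at
--    positions r < k−1 and its only gap ρ_d (d = −u_{k-1}) at position k−1, so
--    before position j of its periodic extension there are exactly ⌊j/k⌋ gaps.
--    Writing D(j) = K(j+1) − K(j), the recurrence of K gives
--        D(j) = u_{r+1} − u_r     if j mod k = r < k−1,
--        D(j) = D(⌊j/k⌋) + d      if j mod k = k−1,
--    which is exactly the rule by which T_{e+1} = P^ω⟨T_e⟩ fills position j.
--    By induction on e, T_e agrees with D below e, so D is the Toeplitz word.
module Submission where

open import Defs
open import Data.Nat using (ℕ; suc; _≤_)
open import Data.Fin using (zero)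
open import Data.List using (List; length)
open import Data.Maybe using (just)
open import Data.Product using (∃; _×_)
open import Relation.Binary.PropositionalEquality using (_≡_)

open import Level using (0ℓ)
open import Algebra.Bundles using (AbelianGroup)
open import Algebra.Structures using (IsAbelianGroup)
open import Algebra.Consequences.Propositional using (comm∧idˡ⇒id; comm∧invʳ⇒inv)
open import Data.Nat using (zero; _+_; _*_; _∸_; _^_; _<_; _%_; _/_; _⊔_; z≤n; s≤s; s≤s⁻¹)
open import Data.Nat.Properties
open import Data.Nat.DivMod
open import Data.Fin using (Fin; toℕ) renaming (zero to fz; suc to fsuc)
open import Data.Fin.Properties using (toℕ-injective; toℕ-fromℕ<; toℕ<n)
open import Data.List using ([]; _∷_; _++_; map; zipWith; lookup)
open import Data.List.Properties using (length-map; length-++)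
open import Data.Maybe using (fromMaybe)
import Data.Maybe as Maybe
open import Data.Maybe.Properties using (just-injective)
open import Data.Sum using (_⊎_; inj₁; inj₂)
open import Data.Sum.Properties using (inj₁-injective)
open import Data.Product using (_,_)
open import Relation.Binary.PropositionalEquality
  using (refl; sym; trans; cong; cong₂; subst; isEquivalence; module ≡-Reasoning)


module CyclicGroup (m : ℕ) where

  open ≡-Reasoning

  private
    N : ℕ
    N = suc m

  toℕ-⊕ : (a b : Alph m) → toℕ (a ⊕ b) ≡ (toℕ a + toℕ b) % N
  toℕ-⊕ a b = toℕ-fromℕ< _

  %-absorbˡ : ∀ x c → (x % N + c) % N ≡ (x + c) % N
  %-absorbˡ x c = begin
    (x % N + c) % N         ≡⟨ %-distribˡ-+ (x % N) c N ⟩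
    (x % N % N + c % N) % N ≡⟨ cong (λ v → (v + c % N) % N) (m%n%n≡m%n x N) ⟩
    (x % N + c % N) % N     ≡⟨ %-distribˡ-+ x c N ⟨
    (x + c) % N             ∎

  ⊕-comm : (a b : Alph m) → a ⊕ b ≡ b ⊕ a
  ⊕-comm a b = toℕ-injective (begin
    toℕ (a ⊕ b)             ≡⟨ toℕ-⊕ a b ⟩
    (toℕ a + toℕ b) % N     ≡⟨ cong (_% N) (+-comm (toℕ a) (toℕ b)) ⟩
    (toℕ b + toℕ a) % N     ≡⟨ toℕ-⊕ b a ⟨
    toℕ (b ⊕ a)             ∎)

  ⊕-assoc : (a b c : Alph m) → (a ⊕ b) ⊕ c ≡ a ⊕ (b ⊕ c)
  ⊕-assoc a b c = toℕ-injective (begin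
    toℕ ((a ⊕ b) ⊕ c)                ≡⟨ toℕ-⊕ (a ⊕ b) c ⟩
    (toℕ (a ⊕ b) + toℕ c) % N        ≡⟨ cong (λ v → (v + toℕ c) % N) (toℕ-⊕ a b) ⟩
    ((toℕ a + toℕ b) % N + toℕ c) % N ≡⟨ %-absorbˡ (toℕ a + toℕ b) (toℕ c) ⟩
    (toℕ a + toℕ b + toℕ c) % N      ≡⟨ cong (_% N) (+-assoc (toℕ a) (toℕ b) (toℕ c)) ⟩
    (toℕ a + (toℕ b + toℕ c)) % N    ≡⟨ cong (_% N) (+-comm (toℕ a) (toℕ b + toℕ c)) ⟩
    ((toℕ b + toℕ c) + toℕ a) % N    ≡⟨ %-absorbˡ (toℕ b + toℕ c) (toℕ a) ⟨
    ((toℕ b + toℕ c) % N + toℕ a) % N ≡⟨ cong (λ v → (v + toℕ a) % N) (toℕ-⊕ b c) ⟨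
    (toℕ (b ⊕ c) + toℕ a) % N        ≡⟨ cong (_% N) (+-comm (toℕ (b ⊕ c)) (toℕ a)) ⟩
    (toℕ a + toℕ (b ⊕ c)) % N        ≡⟨ toℕ-⊕ a (b ⊕ c) ⟨
    toℕ (a ⊕ (b ⊕ c))                ∎)

  ⊕-identityˡ : (a : Alph m) → fz ⊕ a ≡ a
  ⊕-identityˡ a = toℕ-injective (trans (toℕ-⊕ fz a) (m<n⇒m%n≡m (toℕ<n a)))

  -- a + (N − a) = N ≡ 0 (mod N).
  ⊕-inverseʳ : (a : Alph m) → a ⊕ (⊖ a) ≡ fz
  ⊕-inverseʳ a = toℕ-injective (begin
    toℕ (a ⊕ (⊖ a))                  ≡⟨ toℕ-⊕ a (⊖ a) ⟩
    (toℕ a + toℕ (⊖ a)) % N          ≡⟨ cong (λ v → (toℕ a + v) % N) (toℕ-fromℕ< _) ⟩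
    (toℕ a + (N ∸ toℕ a) % N) % N    ≡⟨ cong (_% N) (+-comm (toℕ a) _) ⟩
    ((N ∸ toℕ a) % N + toℕ a) % N    ≡⟨ %-absorbˡ (N ∸ toℕ a) (toℕ a) ⟩
    ((N ∸ toℕ a) + toℕ a) % N        ≡⟨ cong (_% N) (m∸n+n≡m (<⇒≤ (toℕ<n a))) ⟩
    N % N                            ≡⟨ n%n≡0 N ⟩
    0                                ∎)

  isAbelianGroup : IsAbelianGroup _≡_ (_⊕_ {m}) fz (⊖_)
  isAbelianGroup = record
    { isGroup = record
      { isMonoid = record
        { isSemigroup = record
          { isMagma = record { isEquivalence = isEquivalence ; ∙-cong = cong₂ _⊕_ }
          ; assoc = ⊕-assoc
          }
        ; identity = comm∧idˡ⇒id ⊕-comm ⊕-identityˡ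
        }
      ; inverse = comm∧invʳ⇒inv ⊕-comm ⊕-inverseʳ
      ; ⁻¹-cong = cong (⊖_)
      }
    ; comm = ⊕-comm
    }

  abelianGroup : AbelianGroup 0ℓ 0ℓ
  abelianGroup = record { isAbelianGroup = isAbelianGroup }

  open AbelianGroup abelianGroup using (identityʳ; inverseʳ)
  open import Algebra.Properties.AbelianGroup abelianGroup using (⁻¹-∙-comm)

  ⊖-⊕ : (x a c : Alph m) → x ⊖ (a ⊕ c) ≡ (x ⊖ c) ⊖ a
  ⊖-⊕ x a c = begin
    x ⊕ (⊖ (a ⊕ c))          ≡⟨ cong (x ⊕_) (⁻¹-∙-comm a c) ⟨
    x ⊕ ((⊖ a) ⊕ (⊖ c))      ≡⟨ cong (x ⊕_) (⊕-comm (⊖ a) (⊖ c)) ⟩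
    x ⊕ ((⊖ c) ⊕ (⊖ a))      ≡⟨ ⊕-assoc x (⊖ c) (⊖ a) ⟨
    (x ⊕ (⊖ c)) ⊕ (⊖ a)      ∎

  ⊕-⊖-cancel : (b c : Alph m) → (b ⊕ c) ⊖ c ≡ b
  ⊕-⊖-cancel b c = begin
    (b ⊕ c) ⊕ (⊖ c)          ≡⟨ ⊕-assoc b c (⊖ c) ⟩
    b ⊕ (c ⊕ (⊖ c))          ≡⟨ cong (b ⊕_) (inverseʳ c) ⟩
    b ⊕ fz                   ≡⟨ identityʳ b ⟩
    b                        ∎

  ⊖-translate : (a b c : Alph m) → (b ⊕ c) ⊖ (a ⊕ c) ≡ b ⊖ a
  ⊖-translate a b c = trans (⊖-⊕ (b ⊕ c) a c) (cong (_⊖ a) (⊕-⊖-cancel b c))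

module _ {A : Set} where

  !?-map : {B : Set} (f : A → B) (xs : List A) (r : ℕ) → map f xs !? r ≡ Maybe.map f (xs !? r)
  !?-map f [] r = refl
  !?-map f (x ∷ xs) zero = refl
  !?-map f (x ∷ xs) (suc r) = !?-map f xs r

  !?-++ˡ : (xs ys : List A) (r : ℕ) {a : A} → xs !? r ≡ just a → (xs ++ ys) !? r ≡ just a
  !?-++ˡ (x ∷ xs) ys zero e = e
  !?-++ˡ (x ∷ xs) ys (suc r) e = !?-++ˡ xs ys r e

  !?-++ʳ : (xs ys : List A) (j : ℕ) → (xs ++ ys) !? (length xs + j) ≡ ys !? j
  !?-++ʳ [] ys j = refl
  !?-++ʳ (x ∷ xs) ys j = !?-++ʳ xs ys j

  !?-lookup : (xs : List A) (i : Fin (length xs)) → xs !? toℕ i ≡ just (lookup xs i)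
  !?-lookup (x ∷ xs) fz = refl
  !?-lookup (x ∷ xs) (fsuc i) = !?-lookup xs i

  at : A → List A → ℕ → A
  at d xs r = fromMaybe d (xs !? r)

  !?-at : (d : A) (xs : List A) (r : ℕ) → r < length xs → xs !? r ≡ just (at d xs r)
  !?-at d (x ∷ xs) zero _ = refl
  !?-at d (x ∷ xs) (suc r) (s≤s r<) = !?-at d xs r r<

  !?-zipWith-consecutive : (d : A) (g : A → A → A) (x : A) (xs : List A) (r : ℕ) → r < length xs →
    zipWith g (x ∷ xs) xs !? r ≡ just (g (at d (x ∷ xs) r) (at d xs r))
  !?-zipWith-consecutive d g x (x' ∷ xs) zero _ = refl
  !?-zipWith-consecutive d g x (x' ∷ xs) (suc r) (s≤s r<) = !?-zipWith-consecutive d g x' xs r r<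

  length-zipWith-consecutive : (g : A → A → A) (x : A) (xs : List A) →
    length (zipWith g (x ∷ xs) xs) ≡ length xs
  length-zipWith-consecutive g x [] = refl
  length-zipWith-consecutive g x (x' ∷ xs) = cong suc (length-zipWith-consecutive g x' xs)

eventually-unique : {B : Set} (s : ℕ → B) {a b : B} →
  (∃ λ N → ∀ n → N ≤ n → s n ≡ a) → (∃ λ M → ∀ n → M ≤ n → s n ≡ b) → a ≡ b
eventually-unique s (N , sN) (M , sM) =
  trans (sym (sN (N ⊔ M) (m≤m⊔n N M))) (sM (N ⊔ M) (m≤n⊔m N M))

module Digits (l : ℕ) where

  open ≡-Reasoning

  k : ℕ
  k = suc l

  digit-% : ∀ r q → r < k → (r + q * k) % k ≡ r
  digit-% r q r< = trans ([m+kn]%n≡m%n r q k) (m<n⇒m%n≡m r<)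

  digit-/ : ∀ r q → r < k → (r + q * k) / k ≡ q
  digit-/ r q r< = begin
    (r + q * k) / k   ≡⟨ +-distrib-/ r (q * k) no-carry ⟩
    r / k + q * k / k ≡⟨ cong₂ _+_ (m<n⇒m/n≡0 r<) (m*n/n≡m q k) ⟩
    q                 ∎
    where
    no-carry : r % k + (q * k) % k < k
    no-carry = subst (_< k) (sym (trans (cong₂ _+_ (m<n⇒m%n≡m r<) (m*n%n≡0 q k)) (+-identityʳ r))) r<

  successor-digits : ∀ j →
      (j % k < l × suc j % k ≡ suc (j % k) × suc j / k ≡ j / k)
    ⊎ (j % k ≡ l × suc j % k ≡ 0 × suc j / k ≡ suc (j / k))
  successor-digits j with m≤n⇒m<n∨m≡n (s≤s⁻¹ (m%n<n j k))
  ... | inj₁ r<l = inj₁ (r<l , trans (cong (_% k) sj) (digit-% _ (j / k) (s≤s r<l))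
                             , trans (cong (_/ k) sj) (digit-/ _ (j / k) (s≤s r<l)))
    where
    sj : suc j ≡ suc (j % k) + (j / k) * k
    sj = cong suc (m≡m%n+[m/n]*n j k)
  ... | inj₂ r≡l = inj₂ (r≡l , trans (cong (_% k) sj) (digit-% 0 (suc (j / k)) (s≤s z≤n))
                             , trans (cong (_/ k) sj) (digit-/ 0 (suc (j / k)) (s≤s z≤n)))
    where
    sj : suc j ≡ 0 + suc (j / k) * k
    sj = trans (cong suc (m≡m%n+[m/n]*n j k)) (cong (λ v → suc v + (j / k) * k) r≡l)

-- For k ≥ 2 the exponent n is smaller than k ^ n, so u^{×n} eventually covers position n.
exponent<power : ∀ l n → n < suc (suc l) ^ n
exponent<power l zero = s≤s z≤n
exponent<power l (suc n) = begin-strict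
  1 + n                 ≤⟨ +-monoˡ-≤ n (m^n>0 k n) ⟩
  k ^ n + n             <⟨ +-monoʳ-< (k ^ n) (exponent<power l n) ⟩
  k ^ n + k ^ n         ≡⟨ cong (k ^ n +_) (+-identityʳ (k ^ n)) ⟨
  2 * k ^ n             ≤⟨ *-monoˡ-≤ (k ^ n) (s≤s (s≤s (z≤n {l}))) ⟩
  k * k ^ n             ∎
  where
  open ≤-Reasoning
  k : ℕ
  k = suc (suc l)

module _ {m : ℕ} where

  open ≡-Reasoning

  lastOr-at : (d x : Alph m) (xs : List (Alph m)) → lastOr x xs ≡ at d (x ∷ xs) (length xs)
  lastOr-at d x [] = refl
  lastOr-at d x (x' ∷ xs) = lastOr-at d x' xs

  ×K-!? : (u v : List (Alph m)) (q r : ℕ) {a : Alph m} → u !? r ≡ just a →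
    (u ×K v) !? (r + q * length u) ≡ Maybe.map (a ⊕_) (v !? q)
  ×K-!? u [] q r e = refl
  ×K-!? u (b ∷ v) zero r {a} e = begin
    (map (_⊕ b) u ++ (u ×K v)) !? (r + 0) ≡⟨ cong ((map (_⊕ b) u ++ (u ×K v)) !?_) (+-identityʳ r) ⟩
    (map (_⊕ b) u ++ (u ×K v)) !? r       ≡⟨ !?-++ˡ (map (_⊕ b) u) (u ×K v) r (trans (!?-map (_⊕ b) u r) (cong (Maybe.map (_⊕ b)) e)) ⟩
    just (a ⊕ b)                          ∎
  ×K-!? u (b ∷ v) (suc q) r {a} e = begin
    (bu ++ (u ×K v)) !? (r + (length u + q * length u))   ≡⟨ cong ((bu ++ (u ×K v)) !?_) shift ⟩
    (bu ++ (u ×K v)) !? (length bu + (r + q * length u))  ≡⟨ !?-++ʳ bu (u ×K v) _ ⟩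
    (u ×K v) !? (r + q * length u)                        ≡⟨ ×K-!? u v q r e ⟩
    Maybe.map (a ⊕_) (v !? q)                             ∎
    where
    bu : List (Alph m)
    bu = map (_⊕ b) u
    shift : r + (length u + q * length u) ≡ length bu + (r + q * length u)
    shift = trans (+-comm r _) (trans (+-assoc (length u) _ r)
              (cong₂ _+_ (sym (length-map (_⊕ b) u)) (+-comm (q * length u) r)))

  fill-letter : (x z : ℕ → Sym {m}) (j : ℕ) {a : Alph m} → x j ≡ inj₁ a → fill x z j ≡ inj₁ a
  fill-letter x z j e rewrite e = refl

  fill-gap : (x z : ℕ → Sym {m}) (j : ℕ) {f : Alph m → Alph m} → x j ≡ inj₂ f →
    fill x z j ≡ fillWith f (z (gapsBefore x j))
  fill-gap x z j e rewrite e = refl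

  !?-periodic : (s : Sym {m}) (ss : List Sym) (j : ℕ) →
    (s ∷ ss) !? (j % suc (length ss)) ≡ just (periodic (s ∷ ss) j)
  !?-periodic s ss j = trans (cong ((s ∷ ss) !?_) (sym (toℕ-fromℕ< (m%n<n j (suc (length ss))))))
                             (!?-lookup (s ∷ ss) (j mod suc (length ss)))

module KeaneToeplitz (m : ℕ) (y : Alph m) (ys : List (Alph m)) where

  open ≡-Reasoning
  open CyclicGroup m
  open Digits (suc (length ys))

  u : List (Alph m)
  u = fz ∷ y ∷ ys

  -- the letter u_r (0 beyond the end)
  uAt : ℕ → Alph m
  uAt = at fz u

  u-!? : ∀ r → r < k → u !? r ≡ just (uAt r)
  u-!? = !?-at fz u

  -- The closed form K(n) = u_{n mod k} + K(⌊n/k⌋), computed with fuel f ≥ n.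
  keaneWith : ℕ → ℕ → Alph m
  keaneWith zero n = fz
  keaneWith (suc f) n = uAt (n % k) ⊕ keaneWith f (n / k)

  keane : ℕ → Alph m
  keane n = keaneWith n n

  keaneWith-0 : ∀ f → keaneWith f 0 ≡ fz
  keaneWith-0 zero = refl
  keaneWith-0 (suc f) = begin
    uAt 0 ⊕ keaneWith f (0 / k) ≡⟨ cong (λ q → fz ⊕ keaneWith f q) (0/n≡0 k) ⟩
    fz ⊕ keaneWith f 0          ≡⟨ ⊕-identityˡ _ ⟩
    keaneWith f 0               ≡⟨ keaneWith-0 f ⟩
    fz                          ∎

  -- Since k ≥ 2 the quotient strictly decreases, which bounds the fuel needed.
  quotient-≤ : ∀ n → suc n / k ≤ n
  quotient-≤ n = s≤s⁻¹ (m/n<m (suc n) k (s≤s (s≤s z≤n)))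

  keaneWith-fuel : ∀ f g n → n ≤ f → n ≤ g → keaneWith f n ≡ keaneWith g n
  keaneWith-fuel f g zero _ _ = trans (keaneWith-0 f) (sym (keaneWith-0 g))
  keaneWith-fuel (suc f) (suc g) (suc n) (s≤s n≤f) (s≤s n≤g) =
    cong (uAt (suc n % k) ⊕_)
      (keaneWith-fuel f g (suc n / k) (≤-trans (quotient-≤ n) n≤f) (≤-trans (quotient-≤ n) n≤g))

  keane-digits : ∀ n → keane n ≡ uAt (n % k) ⊕ keane (n / k)
  keane-digits zero = sym (begin
    uAt 0 ⊕ keane (0 / k) ≡⟨ cong (λ q → fz ⊕ keane q) (0/n≡0 k) ⟩
    fz ⊕ fz               ≡⟨ ⊕-identityˡ fz ⟩
    fz                    ∎)
  keane-digits (suc n) =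
    cong (uAt (suc n % k) ⊕_) (keaneWith-fuel n (suc n / k) (suc n / k) (quotient-≤ n) ≤-refl)

  kpow-!? : ∀ n i → i < k ^ n → kpow u n !? i ≡ just (keane i)
  kpow-!? zero zero _ = refl
  kpow-!? zero (suc i) (s≤s ())
  kpow-!? (suc n) i i< = begin
    (u ×K kpow u n) !? i                           ≡⟨ cong ((u ×K kpow u n) !?_) (m≡m%n+[m/n]*n i k) ⟩
    (u ×K kpow u n) !? (i % k + (i / k) * k)       ≡⟨ ×K-!? u (kpow u n) (i / k) (i % k) (u-!? (i % k) (m%n<n i k)) ⟩
    Maybe.map (uAt (i % k) ⊕_) (kpow u n !? (i / k)) ≡⟨ cong (Maybe.map (uAt (i % k) ⊕_)) (kpow-!? n (i / k) q<) ⟩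
    just (uAt (i % k) ⊕ keane (i / k))             ≡⟨ cong just (keane-digits i) ⟨
    just (keane i)                                 ∎
    where
    q< : i / k < k ^ n
    q< = m<n*o⇒m/o<n (subst (i <_) (*-comm k (k ^ n)) i<)

  -- Position i of u^{×n} is settled once n > i, as i < k^i ≤ k^n.
  kpow-stable : ∀ i n → suc i ≤ n → kpow u n !? i ≡ just (keane i)
  kpow-stable i n i<n =
    kpow-!? n i (<-≤-trans (exponent<power (length ys) i) (^-monoʳ-≤ k (<⇒≤ i<n)))

  keane-isKeaneWord : IsKeaneWord u keane
  keane-isKeaneWord i = suc i , kpow-stable i

  keane-unique : ∀ x → IsKeaneWord u x → ∀ i → x i ≡ keane i
  keane-unique x isK i = just-injective (eventually-unique (λ n → kpow u n !? i) (isK i) (suc i , kpow-stable i))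

  P : List Sym
  P = ΔT u

  d : Alph m
  d = ⊖ uAt (suc (length ys))

  -- Δ u has k − 1 letters, so the gap of P sits at position k − 1 and |P| = k.
  length-letters : length (map (inj₁ {B = Alph m → Alph m}) (Δ u)) ≡ suc (length ys)
  length-letters = trans (length-map inj₁ (Δ u)) (length-zipWith-consecutive _ fz (y ∷ ys))

  P-letter : ∀ r → r < suc (length ys) → P !? r ≡ just (inj₁ (uAt (suc r) ⊖ uAt r))
  P-letter r r< = !?-++ˡ (map inj₁ (Δ u)) _ r (begin
    map inj₁ (Δ u) !? r           ≡⟨ !?-map inj₁ (Δ u) r ⟩
    Maybe.map inj₁ (Δ u !? r)     ≡⟨ cong (Maybe.map inj₁) (!?-zipWith-consecutive fz (λ a b → b ⊖ a) fz (y ∷ ys) r r<) ⟩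
    just (inj₁ (uAt (suc r) ⊖ uAt r)) ∎)

  P-gap : P !? suc (length ys) ≡ just (inj₂ (ρ d))
  P-gap = begin
    P !? suc (length ys)                     ≡⟨ cong (P !?_) (trans (sym length-letters) (sym (+-identityʳ _))) ⟩
    P !? (length (map inj₁ (Δ u)) + 0)       ≡⟨ !?-++ʳ (map inj₁ (Δ u)) _ 0 ⟩
    just (inj₂ (ρ (⊖ lastOr fz u)))          ≡⟨ cong (λ z → just (inj₂ (ρ (⊖ z)))) (lastOr-at fz y ys) ⟩
    just (inj₂ (ρ d))                        ∎

  length-P : length P ≡ k
  length-P = trans (length-++ (map inj₁ (Δ u))) (trans (cong (_+ 1) length-letters) (+-comm _ 1))

  P-periodic : ∀ j → P !? (j % k) ≡ just (periodic P j)
  P-periodic j = trans (cong (λ n → P !? (j % suc n)) (sym (suc-injective length-P))) (!?-periodic _ _ j)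

  periodic-letter : ∀ j → j % k < suc (length ys) → periodic P j ≡ inj₁ (uAt (suc (j % k)) ⊖ uAt (j % k))
  periodic-letter j r< = just-injective (trans (sym (P-periodic j)) (P-letter (j % k) r<))

  periodic-gap : ∀ j → j % k ≡ suc (length ys) → periodic P j ≡ inj₂ (ρ d)
  periodic-gap j r≡ = just-injective (trans (sym (P-periodic j)) (trans (cong (P !?_) r≡) P-gap))

  -- One gap per period, at its end: ⌊j/k⌋ gaps precede position j.
  gapsBefore-periodic : ∀ j → gapsBefore (periodic P) j ≡ j / k
  gapsBefore-periodic zero = sym (0/n≡0 k)
  gapsBefore-periodic (suc j) with successor-digits j
  ... | inj₁ (r< , _ , sj/) = begin
    gapsBefore (periodic P) j + isGap (periodic P j) ≡⟨ cong₂ _+_ (gapsBefore-periodic j) (cong isGap (periodic-letter j r<)) ⟩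
    j / k + 0                                        ≡⟨ +-identityʳ _ ⟩
    j / k                                            ≡⟨ sj/ ⟨
    suc j / k                                        ∎
  ... | inj₂ (r≡ , _ , sj/) = begin
    gapsBefore (periodic P) j + isGap (periodic P j) ≡⟨ cong₂ _+_ (gapsBefore-periodic j) (cong isGap (periodic-gap j r≡)) ⟩
    j / k + 1                                        ≡⟨ +-comm _ 1 ⟩
    suc (j / k)                                      ≡⟨ sj/ ⟨
    suc j / k                                        ∎

  D : ℕ → Alph m
  D j = keane (suc j) ⊖ keane j

  -- Without carry, only the last digit changes.
  D-no-carry : ∀ j → suc j % k ≡ suc (j % k) → suc j / k ≡ j / k → D j ≡ uAt (suc (j % k)) ⊖ uAt (j % k)
  D-no-carry j sj% sj/ = begin
    keane (suc j) ⊖ keane j                                    ≡⟨ cong₂ _⊖_ (keane-digits (suc j)) (keane-digits j) ⟩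
    (uAt (suc j % k) ⊕ keane (suc j / k)) ⊖ (uAt r ⊕ keane q) ≡⟨ cong₂ (λ r′ q′ → (uAt r′ ⊕ keane q′) ⊖ (uAt r ⊕ keane q)) sj% sj/ ⟩
    (uAt (suc r) ⊕ keane q) ⊖ (uAt r ⊕ keane q)               ≡⟨ ⊖-translate (uAt r) (uAt (suc r)) (keane q) ⟩
    uAt (suc r) ⊖ uAt r                                        ∎
    where
    r q : ℕ
    r = j % k
    q = j / k

  D-carry : ∀ j → j % k ≡ suc (length ys) → suc j % k ≡ 0 → suc j / k ≡ suc (j / k) → D j ≡ D (j / k) ⊕ d
  D-carry j r≡ sj% sj/ = begin
    keane (suc j) ⊖ keane j                                    ≡⟨ cong₂ _⊖_ (keane-digits (suc j)) (keane-digits j) ⟩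
    (uAt (suc j % k) ⊕ keane (suc j / k)) ⊖ (uAt r ⊕ keane q) ≡⟨ cong₂ (λ r′ q′ → (uAt r′ ⊕ keane q′) ⊖ (uAt r ⊕ keane q)) sj% sj/ ⟩
    (fz ⊕ keane (suc q)) ⊖ (uAt r ⊕ keane q)                  ≡⟨ cong₂ (λ a r′ → a ⊖ (uAt r′ ⊕ keane q)) (⊕-identityˡ (keane (suc q))) r≡ ⟩
    keane (suc q) ⊖ (uAt (suc (length ys)) ⊕ keane q)          ≡⟨ ⊖-⊕ (keane (suc q)) (uAt (suc (length ys))) (keane q) ⟩
    D q ⊕ d                                                    ∎
    where
    r q : ℕ
    r = j % k
    q = j / k

  Tseq-D : ∀ e j → j < e → Tseq P e j ≡ inj₁ (D j)
  Tseq-D (suc e) j (s≤s j≤e) with successor-digits j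
  ... | inj₁ (r< , sj% , sj/) =
    trans (fill-letter (periodic P) (Tseq P e) j (periodic-letter j r<)) (cong inj₁ (sym (D-no-carry j sj% sj/)))
  ... | inj₂ (r≡ , sj% , sj/) = begin
    fill (periodic P) (Tseq P e) j                         ≡⟨ fill-gap (periodic P) (Tseq P e) j (periodic-gap j r≡) ⟩
    fillWith (ρ d) (Tseq P e (gapsBefore (periodic P) j))  ≡⟨ cong (λ g → fillWith (ρ d) (Tseq P e g)) (gapsBefore-periodic j) ⟩
    fillWith (ρ d) (Tseq P e (j / k))                      ≡⟨ cong (fillWith (ρ d)) (Tseq-D e (j / k) q<) ⟩
    inj₁ (D (j / k) ⊕ d)                                   ≡⟨ cong inj₁ (D-carry j r≡ sj% sj/) ⟨
    inj₁ (D j)                                             ∎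
    where
    q< : j / k < e
    q< = ≤-trans (≤-reflexive (sym sj/)) (≤-trans (quotient-≤ j) j≤e)

  D-isToeplitzWord : IsToeplitzWord P D
  D-isToeplitzWord j = suc j , λ e → Tseq-D e j

  toeplitz-unique : ∀ z → IsToeplitzWord P z → ∀ j → z j ≡ D j
  toeplitz-unique z isT j = inj₁-injective (eventually-unique (λ e → Tseq P e j) (isT j) (D-isToeplitzWord j))

mainTheorem3 : (m : ℕ) (u : List (Alph m)) → 2 ≤ length u → u !? 0 ≡ just zero →
    (∃ λ x → IsKeaneWord u x) × (∃ λ y → IsToeplitzWord (ΔT u) y) ×
    (∀ (x y : ℕ → Alph m) → IsKeaneWord u x → IsToeplitzWord (ΔT u) y →
    ∀ n → x (suc n) ⊖ x n ≡ y n)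
mainTheorem3 m (_ ∷ []) (s≤s ()) _
mainTheorem3 m (.fz ∷ y ∷ ys) _ refl =
  (keane , keane-isKeaneWord) , (D , D-isToeplitzWord) , Δx≡z
  where
  open KeaneToeplitz m y ys
  open ≡-Reasoning
  Δx≡z : ∀ (x z : ℕ → Alph m) → IsKeaneWord u x → IsToeplitzWord P z → ∀ n → x (suc n) ⊖ x n ≡ z n
  Δx≡z x z isK isT n = begin
    x (suc n) ⊖ x n  ≡⟨ cong₂ _⊖_ (keane-unique x isK (suc n)) (keane-unique x isK n) ⟩
    D n              ≡⟨ toeplitz-unique z isT n ⟨
    z n              ∎
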